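{- Let $\alpha>1$. Let $r',r''$ be two distinct maximal repetitions of a word $w$ with the same cyclic roots and with $|r'|\le|r''|$. Suppose that some maximal $\alpha$-gapped repeat of $w$ is represented by the pair $(r',r'')$. Then $\mathrm{beg}(r'')-\mathrm{beg}(r')\le\alpha|r'|$.
   Context: $w$ has length $n$. For a factor $w[i..j]$ we write $\mathrm{beg}=i$ and $\mathrm{end}=j$. A period of a word $x$ is any $p$ with $x[i]=x[i+p]$ for all valid $i$; $p(x)$ is the minimal period and $e(x)=|x|/p(x)$. A maximal repetition is a factor $r$ with $e(r)\ge2$ satisfying two conditions: if $\mathrm{beg}(r)>1$ then $w[\mathrm{beg}(r)-1]\ne w[\mathrm{beg}(r)+p(r)-1]$, and if $\mathrm{end}(r)<n$ then $w[\mathrm{end}(r)-p(r)+1]\ne w[\mathrm{end}(r)+1]$. Every factor $x$ with $e(x)\ge2$ lies in a unique maximal repetition with the same minimal period. A cyclic root of a repetition $r$ is a factor of length $p(r)$ contained in $r$. Two repetitions have the same cyclic roots if they have the same minimal period and the same set of distinct cyclic roots, viewed as words. A repeat $\sigma$ is a pair $(u',u'')$ of nonempty factors equal as words, with $\mathrm{beg}(u')<\mathrm{beg}(u'')$. It has $c(\sigma)=|u'|$ and $p(\sigma)=\mathrm{beg}(u'')-\mathrm{beg}(u')$. It is maximal if two conditions hold: if $\mathrm{beg}(u')>1$ then $w[\mathrm{beg}(u')-1]\ne w[\mathrm{beg}(u'')-1]$, and if $\mathrm{end}(u'')<n$ then $w[\mathrm{end}(u')+1]\ne w[\mathrm{end}(u'')+1]$.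 It is gapped if $\mathrm{beg}(u'')>\mathrm{end}(u')+1$. A gapped repeat is $\alpha$-gapped if $p(\sigma)\le\alpha c(\sigma)$. The repeat is periodic if its copies are repetitions whose minimal period $q$ satisfies $q\le c(\sigma)/3$. A maximal periodic repeat $\sigma$ is represented by the pair $(r',r'')$, with $r'\ne r''$, if $r'$ is the maximal repetition with minimal period $q$ containing $u'$ and $r''$ is the one containing $u''$.
   Formalization: The parameter α ranges over the rationals greater than 1. -}

module Defs where

open import Data.Nat using (ℕ; zero; suc; _+_; _*_; _∸_; _≤_; _<_)
open import Data.Product using (_×_; Σ; ∃; _,_)
open import Relation.Binary.PropositionalEquality using (_≡_; _≢_)
open import Relation.Nullary using (¬_)
open import Data.Integer using (+_)
import Data.Rational as ℚ
open ℚ using (ℚ)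

ℕ→ℚ : ℕ → ℚ
ℕ→ℚ n = (+ n) ℚ./ 1

-- A word w of length n over alphabet A: positions 1..n, w k is the letter
-- at position k (values of w outside [1,n] are never consulted).
record Factor : Set where
  constructor ⟦_,_⟧
  field
    beg : ℕ
    end : ℕ
open Factor public

IsFactor : ℕ → Factor → Set
IsFactor n x = (1 ≤ beg x) × (beg x ≤ end x) × (end x ≤ n)

len : Factor → ℕ
len x = suc (end x) ∸ beg x

module _ {A : Set} (w : ℕ → A) where

  HasPeriod : Factor → ℕ → Set
  HasPeriod x p = (1 ≤ p) × (∀ k → beg x ≤ k → k + p ≤ end x → w k ≡ w (k + p))

  MinPeriod : Factor → ℕ → Set
  MinPeriod x p = HasPeriod x p × (∀ q → HasPeriod x q → p ≤ q)

  EqWords : ℕ → ℕ → ℕ → Set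
  EqWords i j m = ∀ t → t < m → w (i + t) ≡ w (j + t)

  MaxRep : ℕ → Factor → ℕ → Set
  MaxRep n r p =
    IsFactor n r × MinPeriod r p × (2 * p ≤ len r)
    × (1 < beg r → w (beg r ∸ 1) ≢ w (beg r + p ∸ 1))
    × (end r < n → w (end r + 1 ∸ p) ≢ w (end r + 1))

  RootPos : Factor → ℕ → ℕ → Set
  RootPos r p k = (beg r ≤ k) × (k + p ∸ 1 ≤ end r)

  SameCyclicRoots : Factor → Factor → ℕ → Set
  SameCyclicRoots r' r'' p =
    MinPeriod r' p × MinPeriod r'' p
    × (∀ k → RootPos r' p k → ∃ λ k' → RootPos r'' p k' × EqWords k k' p)
    × (∀ k' → RootPos r'' p k' → ∃ λ k → RootPos r' p k × EqWords k k' p)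

  record Repeat : Set where
    constructor rep
    field
      b'  : ℕ
      b'' : ℕ
      c   : ℕ

  u' : Repeat → Factor
  u' σ = ⟦ Repeat.b' σ , Repeat.b' σ + Repeat.c σ ∸ 1 ⟧

  u'' : Repeat → Factor
  u'' σ = ⟦ Repeat.b'' σ , Repeat.b'' σ + Repeat.c σ ∸ 1 ⟧

  cσ : Repeat → ℕ
  cσ = Repeat.c

  pσ : Repeat → ℕ
  pσ σ = Repeat.b'' σ ∸ Repeat.b' σ

  IsRepeat : ℕ → Repeat → Set
  IsRepeat n σ =
    (1 ≤ cσ σ) × IsFactor n (u' σ) × IsFactor n (u'' σ)
    × (beg (u' σ) < beg (u'' σ)) × EqWords (beg (u' σ)) (beg (u'' σ)) (cσ σ)

  IsMaximalRepeat : ℕ → Repeat → Set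
  IsMaximalRepeat n σ =
    IsRepeat n σ
    × (1 < beg (u' σ) → w (beg (u' σ) ∸ 1) ≢ w (beg (u'' σ) ∸ 1))
    × (end (u'' σ) < n → w (end (u' σ) + 1) ≢ w (end (u'' σ) + 1))

  IsGapped : Repeat → Set
  IsGapped σ = end (u' σ) + 1 < beg (u'' σ)

  IsAlphaGapped : ℚ → Repeat → Set
  IsAlphaGapped α σ = IsGapped σ × (ℕ→ℚ (pσ σ) ℚ.≤ α ℚ.* ℕ→ℚ (cσ σ))

  IsPeriodicWith : Repeat → ℕ → Set
  IsPeriodicWith σ q =
    MinPeriod (u' σ) q × MinPeriod (u'' σ) q × (3 * q ≤ cσ σ)

  _⊑_ : Factor → Factor → Set
  x ⊑ y = (beg y ≤ beg x) × (end x ≤ end y)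

  RepresentedBy : ℕ → Repeat → Factor → Factor → Set
  RepresentedBy n σ r' r'' =
    IsMaximalRepeat n σ × (r' ≢ r'')
    × Σ ℕ λ q → IsPeriodicWith σ q
      × MaxRep n r' q × (u' σ ⊑ r')
      × MaxRep n r'' q × (u'' σ ⊑ r'')

-- Both copies of σ lie inside their repetitions, so beg r'' ≤ beg u'' = beg u' + p(σ), while
-- r' contains the stretch from beg r' to end u', of length (beg u' − beg r') + c(σ). Hence
-- beg r'' − beg r' ≤ (beg u' − beg r') + p(σ) ≤ (beg u' − beg r') + α c(σ) ≤ α |r'|,
-- the last step because α ≥ 1.
module Submission where

open import Defs
open import Data.Nat using (ℕ; suc; _+_; _∸_; _≤_; z≤n; s≤s)
open import Data.Nat.Properties
  using (≤-trans; ≤-reflexive; m≤n⇒m≤1+n; <⇒≤; +-assoc; +-suc; m+[n∸m]≡n; m+n∸m≡n; ∸-monoˡ-≤;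
         module ≤-Reasoning)
open import Data.Nat.Coprimality using (1-coprimeTo) renaming (sym to coprime-sym)
open import Function using (_$_)
open import Data.Product using (_×_; ∃; _,_; proj₁)
open import Data.Integer using (+_; +≤+)
import Data.Integer as ℤ
import Data.Integer.Properties as ℤ
import Data.Rational as ℚ
open ℚ using (ℚ; 0ℚ; 1ℚ; mkℚ; *≤*)
import Data.Rational.Properties as ℚ
open import Algebra.Properties.AbelianGroup ℚ.+-0-abelianGroup using (xyx⁻¹≈y)
open import Relation.Binary.PropositionalEquality
  using (_≡_; _≢_; refl; sym; trans; cong; subst; subst₂; module ≡-Reasoning)

ℕ→ℚ≡mkℚ : ∀ n → ℕ→ℚ n ≡ mkℚ (+ n) 0 (coprime-sym (1-coprimeTo n))
ℕ→ℚ≡mkℚ n = ℚ.normalize-coprime (coprime-sym (1-coprimeTo n))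

ℕ→ℚ-homo-+ : ∀ m n → ℕ→ℚ (m + n) ≡ ℕ→ℚ m ℚ.+ ℕ→ℚ n
ℕ→ℚ-homo-+ m n rewrite ℕ→ℚ≡mkℚ m | ℕ→ℚ≡mkℚ n
  | ℤ.*-identityʳ (+ m) | ℤ.*-identityʳ (+ n) = refl

ℕ→ℚ-mono-≤ : ∀ {m n} → m ≤ n → ℕ→ℚ m ℚ.≤ ℕ→ℚ n
ℕ→ℚ-mono-≤ {m} {n} m≤n rewrite ℕ→ℚ≡mkℚ m | ℕ→ℚ≡mkℚ n =
  *≤* (subst₂ ℤ._≤_ (sym (ℤ.*-identityʳ (+ m))) (sym (ℤ.*-identityʳ (+ n))) (+≤+ m≤n))

0≤ℕ→ℚ : ∀ n → 0ℚ ℚ.≤ ℕ→ℚ n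
0≤ℕ→ℚ n = ℕ→ℚ-mono-≤ {n = n} z≤n

ℕ→ℚ-m≤n+o⇒m-n≤o : ∀ m n {o} → m ≤ n + o → ℕ→ℚ m ℚ.- ℕ→ℚ n ℚ.≤ ℕ→ℚ o
ℕ→ℚ-m≤n+o⇒m-n≤o m n {o} m≤n+o = begin
  ℕ→ℚ m ℚ.- ℕ→ℚ n                 ≤⟨ ℚ.+-monoˡ-≤ (ℚ.- ℕ→ℚ n) (ℕ→ℚ-mono-≤ m≤n+o) ⟩
  ℕ→ℚ (n + o) ℚ.- ℕ→ℚ n           ≡⟨ cong (ℚ._- ℕ→ℚ n) (ℕ→ℚ-homo-+ n o) ⟩
  (ℕ→ℚ n ℚ.+ ℕ→ℚ o) ℚ.- ℕ→ℚ n     ≡⟨ xyx⁻¹≈y (ℕ→ℚ n) (ℕ→ℚ o) ⟩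
  ℕ→ℚ o                           ∎
  where open ℚ.≤-Reasoning

d+x≤α[d+y] : ∀ {α d x y} → 1ℚ ℚ.≤ α → 0ℚ ℚ.≤ d → x ℚ.≤ α ℚ.* y → d ℚ.+ x ℚ.≤ α ℚ.* (d ℚ.+ y)
d+x≤α[d+y] {α} {d} {x} {y} 1≤α 0≤d x≤αy = begin
  d ℚ.+ x                ≤⟨ ℚ.+-mono-≤ d≤αd x≤αy ⟩
  α ℚ.* d ℚ.+ α ℚ.* y    ≡⟨ ℚ.*-distribˡ-+ α d y ⟨
  α ℚ.* (d ℚ.+ y)        ∎
  where
  open ℚ.≤-Reasoning
  d≤αd : d ℚ.≤ α ℚ.* d
  d≤αd = subst (ℚ._≤ α ℚ.* d) (ℚ.*-identityˡ d)
               (ℚ.*-monoʳ-≤-nonNeg d {{ℚ.nonNegative 0≤d}} 1≤α)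

m+[[n∸m]+[o∸n]]≡o : ∀ {m n o} → m ≤ n → n ≤ o → m + ((n ∸ m) + (o ∸ n)) ≡ o
m+[[n∸m]+[o∸n]]≡o {m} {n} {o} m≤n n≤o = begin
  m + ((n ∸ m) + (o ∸ n))   ≡⟨ +-assoc m (n ∸ m) (o ∸ n) ⟨
  (m + (n ∸ m)) + (o ∸ n)   ≡⟨ cong (_+ (o ∸ n)) (m+[n∸m]≡n m≤n) ⟩
  n + (o ∸ n)               ≡⟨ m+[n∸m]≡n n≤o ⟩
  o                         ∎
  where open ≡-Reasoning

module _ {A : Set} (w : ℕ → A) where

  ⊑⇒[beg∸beg]+len≤len : ∀ {x y} → beg x ≤ end x → _⊑_ w x y → (beg x ∸ beg y) + len x ≤ len y
  ⊑⇒[beg∸beg]+len≤len {x} {y} bx≤ex (by≤bx , ex≤ey) = begin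
    (beg x ∸ beg y) + len x                    ≡⟨ m+n∸m≡n (beg y) _ ⟨
    beg y + ((beg x ∸ beg y) + len x) ∸ beg y  ≡⟨ cong (_∸ beg y) telescope ⟩
    suc (end x) ∸ beg y                        ≤⟨ ∸-monoˡ-≤ (beg y) (s≤s ex≤ey) ⟩
    len y                                      ∎
    where
    open ≤-Reasoning
    telescope : beg y + ((beg x ∸ beg y) + len x) ≡ suc (end x)
    telescope = m+[[n∸m]+[o∸n]]≡o by≤bx (m≤n⇒m≤1+n bx≤ex)

  len-u' : ∀ σ → 1 ≤ cσ w σ → len (u' w σ) ≡ cσ w σ
  len-u' (rep b' _ (suc c)) (s≤s z≤n) rewrite +-suc b' c =
    trans (cong (_∸ b') (sym (+-suc b' c))) (m+n∸m≡n b' (suc c))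

proposition17 : (α : ℚ) → 1ℚ ℚ.< α
  → {A : Set} (w : ℕ → A) (n : ℕ) (r' r'' : Factor) (p p'' : ℕ)
  → MaxRep w n r' p → MaxRep w n r'' p'' → r' ≢ r''
  → SameCyclicRoots w r' r'' p
  → len r' ≤ len r''
  → (∃ λ σ → IsMaximalRepeat w n σ × IsAlphaGapped w α σ × RepresentedBy w n σ r' r'')
  → ℕ→ℚ (beg r'') ℚ.- ℕ→ℚ (beg r') ℚ.≤ α ℚ.* ℕ→ℚ (len r')
proposition17 α 1<α w n r' r'' _ _ _ _ _ _ _
  (σ@(rep b' _ c) , _ , (_ , pσ≤αc) ,
   ((1≤c , (_ , b'≤e' , _) , _ , b'<b'' , _) , _) ,
   _ , _ , _ , _ , u'⊑r' , _ , (beg-r''≤b'' , _)) = begin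
  ℕ→ℚ (beg r'') ℚ.- ℕ→ℚ (beg r')       ≤⟨ ℕ→ℚ-m≤n+o⇒m-n≤o (beg r'') (beg r') beg-r''≤beg-r'+shift ⟩
  ℕ→ℚ (shift + pσ w σ)                 ≡⟨ ℕ→ℚ-homo-+ shift (pσ w σ) ⟩
  ℕ→ℚ shift ℚ.+ ℕ→ℚ (pσ w σ)           ≤⟨ d+x≤α[d+y] (ℚ.<⇒≤ 1<α) (0≤ℕ→ℚ shift) pσ≤αc ⟩
  α ℚ.* (ℕ→ℚ shift ℚ.+ ℕ→ℚ c)          ≡⟨ cong (α ℚ.*_) (ℕ→ℚ-homo-+ shift c) ⟨
  α ℚ.* ℕ→ℚ (shift + c)                ≤⟨ ℚ.*-monoˡ-≤-nonNeg α {{α-nonNeg}} shift+c≤len-r' ⟩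
  α ℚ.* ℕ→ℚ (len r')                   ∎
  where
  open ℚ.≤-Reasoning
  shift : ℕ
  shift = b' ∸ beg r'
  beg-r''≤beg-r'+shift : beg r'' ≤ beg r' + (shift + pσ w σ)
  beg-r''≤beg-r'+shift =
    ≤-trans beg-r''≤b'' (≤-reflexive (sym (m+[[n∸m]+[o∸n]]≡o (proj₁ u'⊑r') (<⇒≤ b'<b''))))
  shift+c≤len-r' : ℕ→ℚ (shift + c) ℚ.≤ ℕ→ℚ (len r')
  shift+c≤len-r' = ℕ→ℚ-mono-≤ $
    subst (λ l → shift + l ≤ len r') (len-u' w σ 1≤c) (⊑⇒[beg∸beg]+len≤len w b'≤e' u'⊑r')
  α-nonNeg : ℚ.NonNegative α
  α-nonNeg = ℚ.nonNegative (ℚ.≤-trans (0≤ℕ→ℚ 1) (ℚ.<⇒≤ 1<α))
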